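{- Let $n\ge 1$ and $1\le m\le\lfloor n/2\rfloor$. For every $l\in\{0,1,\dots,m-1\}$, $$\#\{\pi\in\mathfrak{S}_n: \mathrm{altmaj}(\pi)\equiv l \pmod{2m}\}=\#\{\pi\in\mathfrak{S}_n: \mathrm{altmaj}(\pi)\equiv l+m \pmod{2m}\}.$$ Consequently, $(1+q^m)$ divides $\sum_{\pi\in\mathfrak{S}_n}q^{\mathrm{altmaj}(\pi)}$ in $\mathbb{Z}[q]$ for $1\le m\le\lfloor n/2\rfloor$.
   Context: $\mathfrak{S}_n$ is the set of permutations $\pi=\pi_1\cdots\pi_n$ of $\{1,\dots,n\}$. The alternating descent set is $\widehat{D}(\pi)=\{2i\in[n-1]: \pi_{2i}<\pi_{2i+1}\}\cup\{2i+1\in[n-1]: \pi_{2i+1}>\pi_{2i+2}\}$ and $\mathrm{altmaj}(\pi)=\sum_{i\in\widehat{D}(\pi)}i$. -}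

module Defs where

open import Data.Bool using (Bool; true; false; if_then_else_; _∧_; not)
open import Data.Nat using (ℕ; zero; suc; _+_; _*_; _∸_; _<ᵇ_; _≡ᵇ_; ∣_-_∣)
open import Data.Nat.Divisibility using (_∣_; _∣?_)
open import Data.Nat.Properties using (_≟_)
open import Data.Fin using (Fin; toℕ)
open import Data.Fin.Properties using () renaming (_≟_ to _≟ᶠ_)
open import Data.List using (List; []; _∷_; map; concatMap; length; filter; filterᵇ; foldr; allFin; upTo; replicate; _++_; sum)
open import Data.Vec using (Vec; toList)
import Data.Vec as V
open import Data.Product using (Σ)
open import Data.Integer using (ℤ; +_) renaming (_*_ to _*ℤ_; _+_ to _+ℤ_)
open import Relation.Nullary using (does)
open import Relation.Binary.PropositionalEquality using (_≡_)

allWords : (n k : ℕ) → List (Vec (Fin n) k)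
allWords n zero    = V.[] ∷ []
allWords n (suc k) = concatMap (λ w → map (λ a → a V.∷ w) (allFin n)) (allWords n k)

notIn : {n : ℕ} → Fin n → List (Fin n) → Bool
notIn a []       = true
notIn a (b ∷ bs) = not (does (a ≟ᶠ b)) ∧ notIn a bs

distinct : {n : ℕ} → List (Fin n) → Bool
distinct []       = true
distinct (a ∷ as) = notIn a as ∧ distinct as

-- A permutation π = π₁⋯πₙ of {1,…,n} is a word of length n with distinct
-- entries; the value i+1 is encoded by the element i of Fin n (this shift
-- preserves all comparisons between entries).
isPerm : {n : ℕ} → Vec (Fin n) n → Bool
isPerm v = distinct (toList v)

𝔖 : (n : ℕ) → List (Vec (Fin n) n)
𝔖 n = filterᵇ isPerm (allWords n n)

isEven : ℕ → Bool
isEven zero          = true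
isEven (suc zero)    = false
isEven (suc (suc k)) = isEven k

altDesAt : ℕ → ℕ → ℕ → Bool
altDesAt i x y = if isEven i then x <ᵇ y else y <ᵇ x

altmajFrom : ℕ → List ℕ → ℕ
altmajFrom i []           = 0
altmajFrom i (x ∷ [])     = 0
altmajFrom i (x ∷ y ∷ ys) =
  (if altDesAt i x y then i else 0) + altmajFrom (suc i) (y ∷ ys)

altmaj : {n : ℕ} → Vec (Fin n) n → ℕ
altmaj π = altmajFrom 1 (map toℕ (toList π))

_≡_[mod_] : ℕ → ℕ → ℕ → Set
a ≡ b [mod k ] = k ∣ ∣ a - b ∣

countAltmajMod : (n k r : ℕ) → ℕ
countAltmajMod n k r = length (filter (λ π → k ∣? ∣ altmaj π - r ∣) (𝔖 n))

countAltmajEq : (n j : ℕ) → ℕ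
countAltmajEq n j = length (filter (λ π → altmaj π ≟ j) (𝔖 n))

-- Polynomials in ℤ[q], as coefficient lists (constant term first).

Poly : Set
Poly = List ℤ

coeff : Poly → ℕ → ℤ
coeff []       k       = + 0
coeff (a ∷ as) zero    = a
coeff (a ∷ as) (suc k) = coeff as k

coeffMul : Poly → Poly → ℕ → ℤ
coeffMul f g k = foldr _+ℤ_ (+ 0) (map (λ i → coeff f i *ℤ coeff g (k ∸ i)) (upTo (suc k)))

_∣ₚ_ : Poly → Poly → Set
h ∣ₚ f = Σ Poly (λ g → (k : ℕ) → coeff f k ≡ coeffMul h g k)

-- 1 + q^m  (for m ≥ 1)
onePlusQ^ : ℕ → Poly
onePlusQ^ m = (+ 1) ∷ (replicate (m ∸ 1) (+ 0) ++ ((+ 1) ∷ []))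

-- Σ_{π ∈ 𝔖ₙ} q^{altmaj(π)}; altmaj(π) ≤ n(n−1)/2 < n·n, so the
-- coefficients of q^0,…,q^{n·n−1} suffice.
altmajPoly : ℕ → Poly
altmajPoly n = map (λ j → + countAltmajEq n j) (upTo (n * n))

-- Write π = p r with |p| = 2m and let π* = reverse(p) r.  Reversal turns the ascent at
-- position i of p into a descent at position 2m − i, which has the same parity as i; so the
-- alternating descents of reverse(p) sit exactly at 2m − i for the alternating non-descents i
-- of p.  Hence altmaj(reverse p) ≡ altmaj(p) − (1 + ⋯ + (2m − 1)) ≡ altmaj(p) + m (mod 2m),
-- and the junction of p and r, at position 2m, contributes nothing modulo 2m.  The involution
-- π ↦ π* of 𝔖ₙ therefore maps the class l (mod 2m) of altmaj onto the class l + m.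
--
-- The quotient of Σ c_j q^j by 1 + q^m has coefficients g(l + t m) = Σ_{s ≤ t} (−1)^(t−s) c(l + s m).
-- Once l + t m is beyond the degree, g(l + t m) = ±(Σ_u c(l + 2m u) − Σ_u c(l + m + 2m u)),
-- which vanishes by the first part; so the quotient is a polynomial.

module Submission where

open import Defs
open import Algebra.Bundles using (CommutativeMonoid)
import Algebra.Properties.CommutativeSemigroup as CommSemigroupProperties
open import Data.Bool using (Bool; true; false; if_then_else_; not; _∧_; T)
open import Data.Bool.Properties using (∧-commutativeMonoid; not-injective; not-involutive; T-≡)
open import Data.Empty using (⊥-elim)
open import Data.Fin using (Fin; toℕ)
open import Data.Fin.Properties using (toℕ-injective) renaming (_≟_ to _≟ᶠ_)
import Data.Integer as ℤ
open import Data.Integer using (ℤ)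
import Data.Integer.Properties as ℤₚ
import Data.Integer.Tactic.RingSolver as ℤ-Ring
open import Data.List using (List; []; _∷_; _++_; _∷ʳ_; length; map; filter; filterᵇ; reverse; take; drop; concatMap; allFin; applyUpTo; upTo; replicate; foldr)
open import Data.List.Properties using (length-reverse; length-take; length-map; take++drop≡id; map-++; reverse-map; take-map; drop-map; map-∘; map-cong; map-upTo; unfold-reverse; reverse-involutive)
open import Data.List.Membership.Propositional using (_∈_)
open import Data.List.Membership.Propositional.Properties using (∈-map⁺; ∈-map⁻; ∈-concat⁺′; ∈-concat⁻′; ∈-allFin)
open import Data.List.Membership.Propositional.Properties.WithK using (unique∧set⇒bag)
open import Data.List.Relation.Binary.BagAndSetEquality using (∼bag⇒↭)
open import Data.List.Relation.Binary.Permutation.Propositional using (_↭_; prep; swap; ↭-sym) renaming (refl to ↭-refl; trans to ↭-trans)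
import Data.List.Relation.Binary.Permutation.Propositional.Properties as ↭
open import Data.List.Relation.Unary.All using (All; lookup)
open import Data.List.Relation.Unary.Any using (here)
open import Data.List.Relation.Unary.Linked using (Linked; []; [-]; _∷_)
import Data.List.Relation.Unary.Linked.Properties as Linked
open import Data.List.Relation.Unary.Unique.Propositional using (Unique; []; _∷_)
import Data.List.Relation.Unary.Unique.Propositional.Properties as Unique
open import Data.Nat
open import Data.Nat.DivMod
open import Data.Nat.Divisibility using (_∣_; divides; _∣?_; m∣m*n)
open import Data.Nat.ListAction using (sum)
open import Data.Nat.ListAction.Properties using (sum-↭)
open import Data.Nat.Properties
open import Data.Nat.Tactic.RingSolver using (solve-∀)
open import Data.Product using (_×_; _,_; ∃-syntax; proj₁; proj₂)
open import Data.Sum using (inj₁; inj₂)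
open import Data.Vec using (Vec; toList)
import Data.Vec as V
import Data.Vec.Properties as Vₚ
open import Function using (_∘_; _on_; _⇔_; mk⇔; Equivalence)
open import Relation.Nullary using (Dec; yes; no; does; ¬_)
open import Relation.Nullary.Decidable using (dec-true; dec-false)
open import Relation.Unary using (Decidable)
open import Relation.Binary.PropositionalEquality using (_≡_; _≢_; refl; sym; trans; cong; cong₂; subst; module ≡-Reasoning)
open ≡-Reasoning

private
  module +-Semigroup = CommSemigroupProperties +-commutativeSemigroup
  module ∧-Semigroup = CommSemigroupProperties (CommutativeMonoid.commutativeSemigroup ∧-commutativeMonoid)

does-cong : ∀ {A B : Set} → A ⇔ B → (A? : Dec A) (B? : Dec B) → does A? ≡ does B?
does-cong A⇔B (yes a) B? = sym (dec-true B? (Equivalence.to A⇔B a))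
does-cong A⇔B (no ¬a) B? = sym (dec-false B? (¬a ∘ Equivalence.from A⇔B))

k∣m∸n⇒m%k≡n%k : ∀ {m n} k .{{_ : NonZero k}} → n ≤ m → k ∣ m ∸ n → m % k ≡ n % k
k∣m∸n⇒m%k≡n%k {m} {n} k n≤m (divides q m∸n≡q*k) = begin
  m % k             ≡⟨ cong (_% k) (sym (m+[n∸m]≡n n≤m)) ⟩
  (n + (m ∸ n)) % k ≡⟨ cong (λ d → (n + d) % k) m∸n≡q*k ⟩
  (n + q * k) % k   ≡⟨ [m+kn]%n≡m%n n q k ⟩
  n % k             ∎

k∣∣m-n∣⇒m%k≡n%k : ∀ m n k .{{_ : NonZero k}} → k ∣ ∣ m - n ∣ → m % k ≡ n % k
k∣∣m-n∣⇒m%k≡n%k m n k k∣ with ≤-total n m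
... | inj₁ n≤m = k∣m∸n⇒m%k≡n%k k n≤m (subst (k ∣_) (m≤n⇒∣n-m∣≡n∸m n≤m) k∣)
... | inj₂ m≤n = sym (k∣m∸n⇒m%k≡n%k k m≤n (subst (k ∣_) (trans (∣-∣-comm m n) (m≤n⇒∣n-m∣≡n∸m m≤n)) k∣))

m%k≡n%k⇒k∣∣m-n∣ : ∀ m n k .{{_ : NonZero k}} → m % k ≡ n % k → k ∣ ∣ m - n ∣
m%k≡n%k⇒k∣∣m-n∣ m n k eq = divides ∣ m / k - n / k ∣ (begin
  ∣ m - n ∣                                   ≡⟨ cong₂ ∣_-_∣ (m≡m%n+[m/n]*n m k) (m≡m%n+[m/n]*n n k) ⟩
  ∣ m % k + m / k * k - n % k + n / k * k ∣   ≡⟨ cong (λ r → ∣ m % k + m / k * k - r + n / k * k ∣) (sym eq) ⟩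
  ∣ m % k + m / k * k - m % k + n / k * k ∣   ≡⟨ ∣m+n-m+o∣≡∣n-o∣ (m % k) _ _ ⟩
  ∣ m / k * k - n / k * k ∣                   ≡⟨ sym (*-distribʳ-∣-∣ k (m / k) (n / k)) ⟩
  ∣ m / k - n / k ∣ * k                       ∎)

m+x*k≡n+y*k⇒m%k≡n%k : ∀ m n x y k .{{_ : NonZero k}} → m + x * k ≡ n + y * k → m % k ≡ n % k
m+x*k≡n+y*k⇒m%k≡n%k m n x y k eq = begin
  m % k           ≡⟨ sym ([m+kn]%n≡m%n m x k) ⟩
  (m + x * k) % k ≡⟨ cong (_% k) eq ⟩
  (n + y * k) % k ≡⟨ [m+kn]%n≡m%n n y k ⟩
  n % k           ∎

∣∣-∣-shift : ∀ a b s l k .{{_ : NonZero k}} → a % k ≡ (b + s) % k → k ∣ ∣ a - (l + s) ∣ ⇔ k ∣ ∣ b - l ∣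
∣∣-∣-shift a b s l k a≡b+s = mk⇔
  (λ k∣ → subst (k ∣_) shift (m%k≡n%k⇒k∣∣m-n∣ (b + s) (l + s) k (trans (sym a≡b+s) (k∣∣m-n∣⇒m%k≡n%k a (l + s) k k∣))))
  (λ k∣ → m%k≡n%k⇒k∣∣m-n∣ a (l + s) k (trans a≡b+s (k∣∣m-n∣⇒m%k≡n%k (b + s) (l + s) k (subst (k ∣_) (sym shift) k∣))))
  where
  shift : ∣ (b + s) - (l + s) ∣ ≡ ∣ b - l ∣
  shift = trans (cong₂ ∣_-_∣ (+-comm b s) (+-comm l s)) (∣m+n-m+o∣≡∣n-o∣ s b l)

∑< : ℕ → (ℕ → ℕ) → ℕ
∑< zero    f = 0
∑< (suc B) f = ∑< B f + f B

syntax ∑< B (λ u → e) = ∑[ u < B ] e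

∑<-+ : ∀ B f g → ∑[ u < B ] (f u + g u) ≡ ∑< B f + ∑< B g
∑<-+ zero    f g = refl
∑<-+ (suc B) f g = trans (cong (_+ (f B + g B)) (∑<-+ B f g)) (+-Semigroup.interchange (∑< B f) (∑< B g) (f B) (g B))

∑<-cong : ∀ B f g → (∀ u → u < B → f u ≡ g u) → ∑< B f ≡ ∑< B g
∑<-cong zero    f g f≡g = refl
∑<-cong (suc B) f g f≡g = cong₂ _+_ (∑<-cong B f g (λ u u<B → f≡g u (m≤n⇒m≤1+n u<B))) (f≡g B (n<1+n B))

∑<-zero : ∀ B f → (∀ u → u < B → f u ≡ 0) → ∑< B f ≡ 0
∑<-zero zero    f f≡0 = refl
∑<-zero (suc B) f f≡0 = cong₂ _+_ (∑<-zero B f (λ u u<B → f≡0 u (m≤n⇒m≤1+n u<B))) (f≡0 B (n<1+n B))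

𝟙 : Bool → ℕ
𝟙 b = if b then 1 else 0

∑<-𝟙-≟ : ∀ B u₀ → u₀ < B → ∑[ u < B ] 𝟙 (does (u ≟ u₀)) ≡ 1
∑<-𝟙-≟ (suc B) u₀ u₀<1+B with u₀ ≟ B
... | yes refl = begin
  ∑[ u < B ] 𝟙 (does (u ≟ u₀)) + 𝟙 (does (u₀ ≟ u₀))
    ≡⟨ cong₂ _+_ (∑<-zero B _ (λ u u<B → cong 𝟙 (dec-false (u ≟ u₀) (<⇒≢ u<B)))) (cong 𝟙 (dec-true (u₀ ≟ u₀) refl)) ⟩
  1 ∎
... | no u₀≢B = begin
  ∑[ u < B ] 𝟙 (does (u ≟ u₀)) + 𝟙 (does (B ≟ u₀))
    ≡⟨ cong₂ _+_ (∑<-𝟙-≟ B u₀ (≤∧≢⇒< (≤-pred u₀<1+B) u₀≢B)) (cong 𝟙 (dec-false (B ≟ u₀) (u₀≢B ∘ sym))) ⟩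
  1 ∎

count : {A : Set} → (A → Bool) → List A → ℕ
count c xs = sum (map (𝟙 ∘ c) xs)

count-filterᵇ : {A : Set} (b c : A → Bool) (xs : List A) → count c (filterᵇ b xs) ≡ count (λ x → b x ∧ c x) xs
count-filterᵇ b c []       = refl
count-filterᵇ b c (x ∷ xs) with b x
... | true  = cong (𝟙 (c x) +_) (count-filterᵇ b c xs)
... | false = count-filterᵇ b c xs

length-filter : {A : Set} {P : A → Set} (P? : Decidable P) (xs : List A) → length (filter P? xs) ≡ count (does ∘ P?) xs
length-filter P? []       = refl
length-filter P? (x ∷ xs) with P? x
... | yes _ = cong suc (length-filter P? xs)
... | no _  = length-filter P? xs

count-cong : {A : Set} {c d : A → Bool} → (∀ x → c x ≡ d x) → (xs : List A) → count c xs ≡ count d xs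
count-cong c≡d xs = cong sum (map-cong (cong 𝟙 ∘ c≡d) xs)

count-↭ : {A : Set} (c : A → Bool) {xs ys : List A} → xs ↭ ys → count c xs ≡ count c ys
count-↭ c xs↭ys = sum-↭ (↭.map⁺ (𝟙 ∘ c) xs↭ys)

count-map : {A B : Set} (c : B → Bool) (f : A → B) (xs : List A) → count c (map f xs) ≡ count (c ∘ f) xs
count-map c f xs = cong sum (sym (map-∘ xs))

count-false : {A : Set} (c : A → Bool) → (∀ x → c x ≡ false) → (xs : List A) → count c xs ≡ 0
count-false c c≡false []       = refl
count-false c c≡false (x ∷ xs) = trans (cong (λ b → 𝟙 b + count c xs) (c≡false x)) (count-false c c≡false xs)

-- An involution permutes a duplicate-free list containing every element.
count-involution : {A : Set} (F : A → A) → (∀ x → F (F x) ≡ x) → (xs : List A) → Unique xs → (∀ x → x ∈ xs) →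
                   (c : A → Bool) → count c xs ≡ count (c ∘ F) xs
count-involution F F∘F≡id xs unique-xs complete c = trans (count-↭ c (↭-sym Fxs↭xs)) (count-map c F xs)
  where
  F-injective : ∀ {x y} → F x ≡ F y → x ≡ y
  F-injective {x} {y} Fx≡Fy = trans (sym (F∘F≡id x)) (trans (cong F Fx≡Fy) (F∘F≡id y))
  Fxs↭xs : map F xs ↭ xs
  Fxs↭xs = ∼bag⇒↭ (unique∧set⇒bag (Unique.map⁺ F-injective unique-xs) unique-xs
             (λ {x} → mk⇔ (λ _ → complete x) (λ _ → subst (_∈ map F xs) (F∘F≡id x) (∈-map⁺ F (complete (F x))))))

-- Each a with a ≡ l (mod W) lies in exactly one of the classes l + W u, namely u = a / W.
module _ (W : ℕ) .{{_ : NonZero W}} where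

  𝟙-∣∣-∣≡∑ : ∀ l B a → l < W → a < l + W * B → 𝟙 (does (W ∣? ∣ a - l ∣)) ≡ ∑[ u < B ] 𝟙 (does (a ≟ l + W * u))
  𝟙-∣∣-∣≡∑ l B a l<W a<l+WB with W ∣? ∣ a - l ∣
  ... | no W∤ = sym (∑<-zero B _ (λ u _ → cong 𝟙 (dec-false (a ≟ l + W * u) (W∤ ∘ l+Wu-divides u))))
    where
    l+Wu-divides : ∀ u → a ≡ l + W * u → W ∣ ∣ a - l ∣
    l+Wu-divides u refl = subst (W ∣_) (sym (trans (∣-∣-comm (l + W * u) l) (∣m-m+n∣≡n l (W * u)))) (m∣m*n u)
  ... | yes W∣ = sym (trans (∑<-cong B _ _ (λ u _ → cong 𝟙 (does-cong (mk⇔ on-class (λ { refl → a≡l+Wu₀ })) (a ≟ l + W * u) (u ≟ u₀))))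
                            (∑<-𝟙-≟ B u₀ u₀<B))
    where
    u₀ = a / W
    a≡l+Wu₀ : a ≡ l + W * u₀
    a≡l+Wu₀ = trans (m≡m%n+[m/n]*n a W) (cong₂ _+_ (trans (k∣∣m-n∣⇒m%k≡n%k a l W W∣) (m<n⇒m%n≡m l<W)) (*-comm u₀ W))
    u₀<B : u₀ < B
    u₀<B = *-cancelˡ-< W u₀ B (+-cancelˡ-< l (W * u₀) (W * B) (subst (_< l + W * B) a≡l+Wu₀ a<l+WB))
    on-class : ∀ {u} → a ≡ l + W * u → u ≡ u₀
    on-class {u} eq = *-cancelˡ-≡ u u₀ W (+-cancelˡ-≡ l (W * u) (W * u₀) (trans (sym eq) a≡l+Wu₀))

  count-∣∣-∣≡∑ : ∀ {A : Set} (f : A → ℕ) (xs : List A) l B → l < W → (∀ x → f x < l + W * B) →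
                 count (λ x → does (W ∣? ∣ f x - l ∣)) xs ≡ ∑[ u < B ] count (λ x → does (f x ≟ l + W * u)) xs
  count-∣∣-∣≡∑ f []       l B l<W f< = sym (∑<-zero B _ (λ _ _ → refl))
  count-∣∣-∣≡∑ f (x ∷ xs) l B l<W f< = trans (cong₂ _+_ (𝟙-∣∣-∣≡∑ l B (f x) l<W (f< x)) (count-∣∣-∣≡∑ f xs l B l<W f<))
    (sym (∑<-+ B (λ u → 𝟙 (does (f x ≟ l + W * u))) (λ u → count (λ x → does (f x ≟ l + W * u)) xs)))

-- Alternating descents of lists

isEven-suc : ∀ i → isEven (suc i) ≡ not (isEven i)
isEven-suc zero          = refl
isEven-suc (suc zero)    = refl
isEven-suc (suc (suc i)) = isEven-suc i

isEven-2* : ∀ m → isEven (2 * m) ≡ true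
isEven-2* zero    = refl
isEven-2* (suc m) = trans (cong isEven (*-suc 2 m)) (isEven-2* m)

<ᵇ-flip : ∀ x y → x ≢ y → (y <ᵇ x) ≡ not (x <ᵇ y)
<ᵇ-flip zero    zero    x≢y = ⊥-elim (x≢y refl)
<ᵇ-flip zero    (suc y) x≢y = refl
<ᵇ-flip (suc x) zero    x≢y = refl
<ᵇ-flip (suc x) (suc y) x≢y = <ᵇ-flip x y (x≢y ∘ cong suc)

altDesAt-flip : ∀ {i j} x y → x ≢ y → isEven j ≡ isEven i → altDesAt j y x ≡ not (altDesAt i x y)
altDesAt-flip {i} x y x≢y j≡i rewrite j≡i with isEven i
... | true  = <ᵇ-flip x y x≢y
... | false = <ᵇ-flip y x (x≢y ∘ sym)

desWeight nonDesWeight : ℕ → ℕ → ℕ → ℕ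
desWeight    i x y = if altDesAt i x y then i else 0
nonDesWeight i x y = if altDesAt i x y then 0 else i

nonDesSumFrom nonDesCountFrom positionSumFrom : ℕ → List ℕ → ℕ
nonDesSumFrom i (x ∷ y ∷ ys) = nonDesWeight i x y + nonDesSumFrom (suc i) (y ∷ ys)
nonDesSumFrom i _            = 0
nonDesCountFrom i (x ∷ y ∷ ys) = (if altDesAt i x y then 0 else 1) + nonDesCountFrom (suc i) (y ∷ ys)
nonDesCountFrom i _            = 0
positionSumFrom i (x ∷ y ∷ ys) = i + positionSumFrom (suc i) (y ∷ ys)
positionSumFrom i _            = 0

altmajFrom+nonDesSumFrom : ∀ i ys → altmajFrom i ys + nonDesSumFrom i ys ≡ positionSumFrom i ys
altmajFrom+nonDesSumFrom i []           = refl
altmajFrom+nonDesSumFrom i (x ∷ [])     = refl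
altmajFrom+nonDesSumFrom i (x ∷ y ∷ ys) with altDesAt i x y | altmajFrom+nonDesSumFrom (suc i) (y ∷ ys)
... | true  | ih = trans (+-assoc i _ _) (cong (i +_) ih)
... | false | ih = trans (+-Semigroup.x∙yz≈y∙xz (altmajFrom (suc i) (y ∷ ys)) i (nonDesSumFrom (suc i) (y ∷ ys))) (cong (i +_) ih)

positionSumFrom-length : ∀ i k ys → length ys ≡ suc k → 2 * positionSumFrom i ys + k ≡ k * (2 * i + k)
positionSumFrom-length i zero    (x ∷ [])     _   = refl
positionSumFrom-length i (suc k) (x ∷ y ∷ ys) len = begin
  2 * (i + t) + suc k               ≡⟨ regroup i t k ⟩
  2 * i + suc (2 * t + k)           ≡⟨ cong (λ s → 2 * i + suc s) (positionSumFrom-length (suc i) k (y ∷ ys) (suc-injective len)) ⟩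
  2 * i + suc (k * (2 * suc i + k)) ≡⟨ expand i k ⟩
  suc k * (2 * i + suc k)           ∎
  where
  t = positionSumFrom (suc i) (y ∷ ys)
  regroup : ∀ i t k → 2 * (i + t) + suc k ≡ 2 * i + suc (2 * t + k)
  regroup = solve-∀
  expand : ∀ i k → 2 * i + suc (k * (2 * suc i + k)) ≡ suc k * (2 * i + suc k)
  expand = solve-∀

positionSumFrom-double : ∀ m ys → length ys ≡ 2 * m → positionSumFrom 1 ys + m ≡ 2 * m * m
positionSumFrom-double zero    []       _   = refl
positionSumFrom-double (suc m') ys      len = *-cancelˡ-≡ _ _ 2 (begin
  2 * (t + m)             ≡⟨ *-distribˡ-+ 2 t m ⟩
  2 * t + suc k           ≡⟨ +-suc (2 * t) k ⟩
  suc (2 * t + k)         ≡⟨ cong suc (positionSumFrom-length 1 k ys len) ⟩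
  suc (k * (2 * 1 + k))   ≡⟨ square k ⟩
  suc k * suc k           ≡⟨ regroup m ⟩
  2 * (2 * m * m)         ∎)
  where
  m = suc m'
  k = pred (2 * m)
  t = positionSumFrom 1 ys
  square : ∀ k → suc (k * (2 * 1 + k)) ≡ suc k * suc k
  square = solve-∀
  regroup : ∀ m → 2 * m * (2 * m) ≡ 2 * (2 * m * m)
  regroup = solve-∀

altmajFrom-∷ʳ : ∀ j zs w x → altmajFrom j ((zs ∷ʳ w) ∷ʳ x) ≡ altmajFrom j (zs ∷ʳ w) + desWeight (j + length zs) w x
altmajFrom-∷ʳ j []           w x = trans (+-identityʳ _) (cong (λ k → desWeight k w x) (sym (+-identityʳ j)))
altmajFrom-∷ʳ j (z ∷ [])     w x = begin
  desWeight j z w + (desWeight (suc j) w x + 0) ≡⟨ cong (desWeight j z w +_) (+-identityʳ _) ⟩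
  desWeight j z w + desWeight (suc j) w x       ≡⟨ cong₂ _+_ (sym (+-identityʳ _)) (cong (λ k → desWeight k w x) (+-comm 1 j)) ⟩
  (desWeight j z w + 0) + desWeight (j + 1) w x ∎
altmajFrom-∷ʳ j (z ∷ a ∷ zs) w x = begin
  desWeight j z a + altmajFrom (suc j) (((a ∷ zs) ∷ʳ w) ∷ʳ x)
    ≡⟨ cong (desWeight j z a +_) (altmajFrom-∷ʳ (suc j) (a ∷ zs) w x) ⟩
  desWeight j z a + (altmajFrom (suc j) ((a ∷ zs) ∷ʳ w) + desWeight (suc j + length (a ∷ zs)) w x)
    ≡⟨ sym (+-assoc (desWeight j z a) _ _) ⟩
  desWeight j z a + altmajFrom (suc j) ((a ∷ zs) ∷ʳ w) + desWeight (suc j + length (a ∷ zs)) w x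
    ≡⟨ cong (λ k → desWeight j z a + altmajFrom (suc j) ((a ∷ zs) ∷ʳ w) + desWeight k w x) (sym (+-suc j (length (a ∷ zs)))) ⟩
  altmajFrom j ((z ∷ a ∷ zs) ∷ʳ w) + desWeight (j + length (z ∷ a ∷ zs)) w x ∎

-- The pair at position p of x ∷ ys sits at position K ∸ p of the reversed list.  As K is
-- even (by the parity hypothesis) both positions have the same parity, and the pair is read
-- backwards, so exactly one of the two positions is an alternating descent.
altmajFrom-reverse : ∀ i j K x ys → Linked _≢_ (x ∷ ys) →
                     isEven (j + length ys) ≡ not (isEven i) → suc K ≡ i + (j + length ys) →
                     altmajFrom j (reverse (x ∷ ys)) + nonDesSumFrom i (x ∷ ys) ≡ K * nonDesCountFrom i (x ∷ ys)
altmajFrom-reverse i j K x []      _           _      _    = sym (*-zeroʳ K)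
altmajFrom-reverse i j K x (y ∷ q) (x≢y ∷ lnk) parity sum = begin
  altmajFrom j (reverse (x ∷ y ∷ q)) + (nonDesWeight i x y + co)
    ≡⟨ cong (λ zs → altmajFrom j zs + (nonDesWeight i x y + co)) reverse-xyq ⟩
  altmajFrom j ((reverse q ∷ʳ y) ∷ʳ x) + (nonDesWeight i x y + co)
    ≡⟨ cong (_+ (nonDesWeight i x y + co)) (altmajFrom-∷ʳ j (reverse q) y x) ⟩
  altmajFrom j (reverse q ∷ʳ y) + desWeight (j + length (reverse q)) y x + (nonDesWeight i x y + co)
    ≡⟨ cong (λ l → altmajFrom j (reverse q ∷ʳ y) + desWeight (j + l) y x + (nonDesWeight i x y + co)) (length-reverse q) ⟩
  altmajFrom j (reverse q ∷ʳ y) + desWeight J y x + (nonDesWeight i x y + co)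
    ≡⟨ pair-step (altDesAt i x y) (altDesAt J y x) {altmajFrom j (reverse q ∷ʳ y)} {co} (altDesAt-flip {i} {J} x y x≢y J≡i) ih ⟩
  K * nonDesCountFrom i (x ∷ y ∷ q) ∎
  where
  co = nonDesSumFrom (suc i) (y ∷ q)
  J  = j + length q
  reverse-xyq : reverse (x ∷ y ∷ q) ≡ (reverse q ∷ʳ y) ∷ʳ x
  reverse-xyq = trans (unfold-reverse x (y ∷ q)) (cong (_∷ʳ x) (unfold-reverse y q))
  J≡i : isEven J ≡ isEven i
  J≡i = not-injective (trans (sym (isEven-suc J)) (trans (cong isEven (sym (+-suc j (length q)))) parity))
  K≡i+J : K ≡ i + J
  K≡i+J = suc-injective (trans sum (trans (cong (i +_) (+-suc j (length q))) (+-suc i J)))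
  ih : altmajFrom j (reverse q ∷ʳ y) + co ≡ K * nonDesCountFrom (suc i) (y ∷ q)
  ih = trans (cong (λ zs → altmajFrom j zs + co) (sym (unfold-reverse y q)))
             (altmajFrom-reverse (suc i) j K y q lnk
               (trans J≡i (trans (sym (not-involutive (isEven i))) (cong not (sym (isEven-suc i)))))
               (cong suc K≡i+J))
  pair-step : ∀ b b′ {a c N} → b′ ≡ not b → a + c ≡ K * N →
              a + (if b′ then J else 0) + ((if b then 0 else i) + c) ≡ K * ((if b then 0 else 1) + N)
  pair-step true  false {a} {c} refl a+c≡KN = trans (cong (_+ c) (+-identityʳ a)) a+c≡KN
  pair-step false true  {a} {c} {N} refl a+c≡KN = begin
    a + J + (i + c)   ≡⟨ regroup a J i c ⟩
    (i + J) + (a + c) ≡⟨ cong₂ _+_ (sym K≡i+J) a+c≡KN ⟩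
    K + K * N         ≡⟨ sym (*-suc K N) ⟩
    K * (1 + N)       ∎
    where
    regroup : ∀ a J i c → a + J + (i + c) ≡ (i + J) + (a + c)
    regroup = solve-∀

altmajFrom-reverse-double : ∀ m p → length p ≡ 2 * m → Linked _≢_ p →
                            altmajFrom 1 (reverse p) + m * (2 * m) ≡ altmajFrom 1 p + m + nonDesCountFrom 1 p * (2 * m)
altmajFrom-reverse-double zero     []       _   _   = refl
altmajFrom-reverse-double (suc m') (x ∷ ys) len lnk = begin
  rev + m * W            ≡⟨ cong (rev +_) (trans (*-comm m W) (sym (positionSumFrom-double m (x ∷ ys) len))) ⟩
  rev + (tot + m)        ≡⟨ cong (λ t → rev + (t + m)) (sym (altmajFrom+nonDesSumFrom 1 (x ∷ ys))) ⟩
  rev + (alt + co + m)   ≡⟨ regroup rev alt co m ⟩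
  alt + m + (rev + co)   ≡⟨ cong (alt + m +_) rev+co ⟩
  alt + m + W * N        ≡⟨ cong (alt + m +_) (*-comm W N) ⟩
  alt + m + N * W        ∎
  where
  m   = suc m'
  W   = 2 * m
  rev = altmajFrom 1 (reverse (x ∷ ys))
  alt = altmajFrom 1 (x ∷ ys)
  co  = nonDesSumFrom 1 (x ∷ ys)
  tot = positionSumFrom 1 (x ∷ ys)
  N   = nonDesCountFrom 1 (x ∷ ys)
  rev+co : rev + co ≡ W * N
  rev+co = altmajFrom-reverse 1 1 W x ys lnk (trans (cong isEven len) (isEven-2* m)) (cong suc (sym len))
  regroup : ∀ r a c m → r + (a + c + m) ≡ a + m + (r + c)
  regroup = solve-∀

𝟙*-if : ∀ b i → (if b then i else 0) ≡ 𝟙 b * i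
𝟙*-if true  i = sym (+-identityʳ i)
𝟙*-if false i = refl

-- Modulo i + k the junction between q and r contributes nothing.
altmajFrom-++ : ∀ i k q r → length q ≡ suc k →
                ∃[ b ] altmajFrom i (q ++ r) ≡ altmajFrom i q + b * (i + k) + altmajFrom (suc (i + k)) r
altmajFrom-++ i zero (x ∷ []) []      _ = 0 , refl
altmajFrom-++ i zero (x ∷ []) (y ∷ r) _ = 𝟙 (altDesAt i x y) , (begin
  desWeight i x y + altmajFrom (suc i) (y ∷ r)                   ≡⟨ cong (_+ altmajFrom (suc i) (y ∷ r)) (𝟙*-if (altDesAt i x y) i) ⟩
  𝟙 (altDesAt i x y) * i + altmajFrom (suc i) (y ∷ r)            ≡⟨ cong (λ s → 𝟙 (altDesAt i x y) * s + altmajFrom (suc s) (y ∷ r)) (sym (+-identityʳ i)) ⟩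
  𝟙 (altDesAt i x y) * (i + 0) + altmajFrom (suc (i + 0)) (y ∷ r) ∎)
altmajFrom-++ i (suc k) (x ∷ z ∷ q) r len with altmajFrom-++ (suc i) k (z ∷ q) r (suc-injective len)
... | b , eq = b , (begin
  d + altmajFrom (suc i) ((z ∷ q) ++ r)                     ≡⟨ cong (d +_) eq ⟩
  d + (A + b * (suc i + k) + altmajFrom (suc (suc i + k)) r) ≡⟨ regroup d A (b * (suc i + k)) _ ⟩
  d + A + b * (suc i + k) + altmajFrom (suc (suc i + k)) r   ≡⟨ cong (λ s → d + A + b * s + altmajFrom (suc s) r) (sym (+-suc i k)) ⟩
  d + A + b * (i + suc k) + altmajFrom (suc (i + suc k)) r   ∎)
  where
  d = desWeight i x z
  A = altmajFrom (suc i) (z ∷ q)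
  regroup : ∀ d a c e → d + (a + c + e) ≡ d + a + c + e
  regroup = solve-∀

reversePrefix : {A : Set} → ℕ → List A → List A
reversePrefix k xs = reverse (take k xs) ++ drop k xs

take-length-++ : {A : Set} (p r : List A) → take (length p) (p ++ r) ≡ p
take-length-++ []      r = refl
take-length-++ (x ∷ p) r = cong (x ∷_) (take-length-++ p r)

drop-length-++ : {A : Set} (p r : List A) → drop (length p) (p ++ r) ≡ r
drop-length-++ []      r = refl
drop-length-++ (x ∷ p) r = drop-length-++ p r

length-take-≤ : {A : Set} (k : ℕ) (xs : List A) → k ≤ length xs → length (take k xs) ≡ k
length-take-≤ k xs k≤ = trans (length-take k xs) (m≤n⇒m⊓n≡m k≤)

reversePrefix-++ : {A : Set} (p r : List A) → reversePrefix (length p) (p ++ r) ≡ reverse p ++ r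
reversePrefix-++ p r = cong₂ (λ t d → reverse t ++ d) (take-length-++ p r) (drop-length-++ p r)

reversePrefix-↭ : {A : Set} (k : ℕ) (xs : List A) → reversePrefix k xs ↭ xs
reversePrefix-↭ k xs = subst (reversePrefix k xs ↭_) (take++drop≡id k xs) (↭.++⁺ʳ (drop k xs) (↭.↭-reverse (take k xs)))

length-reversePrefix : {A : Set} (k : ℕ) (xs : List A) → length (reversePrefix k xs) ≡ length xs
length-reversePrefix k xs = ↭.↭-length (reversePrefix-↭ k xs)

reversePrefix-involutive : {A : Set} (k : ℕ) (xs : List A) → k ≤ length xs → reversePrefix k (reversePrefix k xs) ≡ xs
reversePrefix-involutive k xs k≤ = begin
  reversePrefix k (rt ++ d)           ≡⟨ cong (λ j → reversePrefix j (rt ++ d)) (sym |rt|) ⟩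
  reversePrefix (length rt) (rt ++ d) ≡⟨ reversePrefix-++ rt d ⟩
  reverse rt ++ d                     ≡⟨ cong (_++ d) (reverse-involutive (take k xs)) ⟩
  take k xs ++ d                      ≡⟨ take++drop≡id k xs ⟩
  xs                                  ∎
  where
  rt = reverse (take k xs)
  d  = drop k xs
  |rt| : length rt ≡ k
  |rt| = trans (length-reverse (take k xs)) (length-take-≤ k xs k≤)

map-reversePrefix : {A B : Set} (f : A → B) (k : ℕ) (xs : List A) → map f (reversePrefix k xs) ≡ reversePrefix k (map f xs)
map-reversePrefix f k xs = trans (map-++ f (reverse (take k xs)) (drop k xs))
  (cong₂ _++_ (trans (reverse-map f (take k xs)) (cong reverse (sym (take-map k xs)))) (sym (drop-map k xs)))

Linked-++⁻ˡ : {A : Set} {R : A → A → Set} (xs : List A) {ys : List A} → Linked R (xs ++ ys) → Linked R xs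
Linked-++⁻ˡ []           _           = []
Linked-++⁻ˡ (x ∷ [])     _           = [-]
Linked-++⁻ˡ (x ∷ y ∷ xs) (Rxy ∷ lnk) = Rxy ∷ Linked-++⁻ˡ (y ∷ xs) lnk

module _ (n : ℕ) where
  private
    prepend : ∀ {k} → Vec (Fin n) k → List (Vec (Fin n) (suc k))
    prepend w = map (V._∷ w) (allFin n)

    concatMap-prepend-unique : ∀ {k} (ws : List (Vec (Fin n) k)) → Unique ws → Unique (concatMap prepend ws)
    concatMap-prepend-unique []       _            = []
    concatMap-prepend-unique (w ∷ ws) (w∉ws ∷ uws) =
      Unique.++⁺ (Unique.map⁺ Vₚ.∷-injectiveˡ (Unique.allFin⁺ n)) (concatMap-prepend-unique ws uws) disjoint
      where
      disjoint : ∀ {v} → ¬ (v ∈ prepend w × v ∈ concatMap prepend ws)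
      disjoint (v∈ , v∈′) with ∈-map⁻ (V._∷ w) v∈ | ∈-concat⁻′ (map prepend ws) v∈′
      ... | _ , _ , refl | vs , v∈vs , vs∈ with ∈-map⁻ prepend vs∈
      ... | w′ , w′∈ws , refl with ∈-map⁻ (V._∷ w′) v∈vs
      ... | _ , _ , eq = lookup w∉ws w′∈ws (Vₚ.∷-injectiveʳ eq)

  allWords-complete : ∀ k (w : Vec (Fin n) k) → w ∈ allWords n k
  allWords-complete zero    V.[]      = here refl
  allWords-complete (suc k) (a V.∷ w) = ∈-concat⁺′ (∈-map⁺ (V._∷ w) (∈-allFin a)) (∈-map⁺ prepend (allWords-complete k w))

  allWords-unique : ∀ k → Unique (allWords n k)
  allWords-unique zero    = All.[] ∷ []
  allWords-unique (suc k) = concatMap-prepend-unique (allWords n k) (allWords-unique k)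

notIn-↭ : ∀ {n} (a : Fin n) {xs ys} → xs ↭ ys → notIn a xs ≡ notIn a ys
notIn-↭ a ↭-refl          = refl
notIn-↭ a (prep x xs↭ys)  = cong (not (does (a ≟ᶠ x)) ∧_) (notIn-↭ a xs↭ys)
notIn-↭ a (swap {xs} x y xs↭ys) =
  trans (∧-Semigroup.x∙yz≈y∙xz (not (does (a ≟ᶠ x))) (not (does (a ≟ᶠ y))) (notIn a xs))
        (cong (λ b → not (does (a ≟ᶠ y)) ∧ (not (does (a ≟ᶠ x)) ∧ b)) (notIn-↭ a xs↭ys))
notIn-↭ a (↭-trans p q)   = trans (notIn-↭ a p) (notIn-↭ a q)

distinct-↭ : ∀ {n} {xs ys : List (Fin n)} → xs ↭ ys → distinct xs ≡ distinct ys
distinct-↭ ↭-refl         = refl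
distinct-↭ (prep x xs↭ys) = cong₂ _∧_ (notIn-↭ x xs↭ys) (distinct-↭ xs↭ys)
distinct-↭ (swap {xs} {ys} x y xs↭ys) = begin
  (not (does (x ≟ᶠ y)) ∧ notIn x xs) ∧ (notIn y xs ∧ distinct xs)
    ≡⟨ ∧-Semigroup.interchange (not (does (x ≟ᶠ y))) (notIn x xs) (notIn y xs) (distinct xs) ⟩
  (not (does (x ≟ᶠ y)) ∧ notIn y xs) ∧ (notIn x xs ∧ distinct xs)
    ≡⟨ cong (λ b → (not b ∧ notIn y xs) ∧ (notIn x xs ∧ distinct xs)) (does-cong (mk⇔ sym sym) (x ≟ᶠ y) (y ≟ᶠ x)) ⟩
  (not (does (y ≟ᶠ x)) ∧ notIn y xs) ∧ (notIn x xs ∧ distinct xs)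
    ≡⟨ cong₂ (λ b c → (not (does (y ≟ᶠ x)) ∧ b) ∧ c) (notIn-↭ y xs↭ys) (cong₂ _∧_ (notIn-↭ x xs↭ys) (distinct-↭ xs↭ys)) ⟩
  (not (does (y ≟ᶠ x)) ∧ notIn y ys) ∧ (notIn x ys ∧ distinct ys) ∎
distinct-↭ (↭-trans p q)  = trans (distinct-↭ p) (distinct-↭ q)

∧≡true : ∀ a {b} → a ∧ b ≡ true → a ≡ true × b ≡ true
∧≡true true {true} refl = refl , refl

distinct⇒Linked : ∀ {n} (xs : List (Fin n)) → distinct xs ≡ true → Linked (_≢_ on toℕ) xs
distinct⇒Linked []           _ = []
distinct⇒Linked (x ∷ [])     _ = [-]
distinct⇒Linked (x ∷ y ∷ ys) d = x≢y ∷ distinct⇒Linked (y ∷ ys) (proj₂ (∧≡true (notIn x (y ∷ ys)) d))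
  where
  x≢y : toℕ x ≢ toℕ y
  x≢y eq with x ≟ᶠ y | proj₁ (∧≡true (not (does (x ≟ᶠ y))) (proj₁ (∧≡true (notIn x (y ∷ ys)) d)))
  ... | yes _  | ()
  ... | no x≢y | _ = x≢y (toℕ-injective eq)

-- The prefix-reversal involution

module _ (m : ℕ) .{{_ : NonZero m}} where
  private
    W = 2 * m
    instance
      W≢0 : NonZero W
      W≢0 = m*n≢0 2 m

  altmajFrom-2m-++ : ∀ q r → length q ≡ W → ∃[ b ] altmajFrom 1 (q ++ r) ≡ altmajFrom 1 q + b * W + altmajFrom (suc W) r
  altmajFrom-2m-++ q r len = subst (λ w → ∃[ b ] altmajFrom 1 (q ++ r) ≡ altmajFrom 1 q + b * w + altmajFrom (suc w) r)
                               (suc-pred W) (altmajFrom-++ 1 (pred W) q r (trans len (sym (suc-pred W))))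

  altmajFrom-reverse-++ : ∀ p r → length p ≡ W → Linked _≢_ p →
                          altmajFrom 1 (reverse p ++ r) % W ≡ (altmajFrom 1 (p ++ r) + m) % W
  altmajFrom-reverse-++ p r len lnk
      with altmajFrom-2m-++ p r len | altmajFrom-2m-++ (reverse p) r (trans (length-reverse p) len)
  ... | b , p++r | b′ , rev++r = m+x*k≡n+y*k⇒m%k≡n%k _ _ (m + b) (N + b′) W (begin
    altmajFrom 1 (reverse p ++ r) + (m + b) * W ≡⟨ cong (_+ (m + b) * W) rev++r ⟩
    rev + b′ * W + R + (m + b) * W             ≡⟨ regroup₁ rev b′ W R m b ⟩
    (rev + m * W) + b′ * W + R + b * W         ≡⟨ cong (λ s → s + b′ * W + R + b * W) (altmajFrom-reverse-double m p len lnk) ⟩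
    (alt + m + N * W) + b′ * W + R + b * W     ≡⟨ regroup₂ alt m N W b′ R b ⟩
    (alt + b * W + R) + m + (N + b′) * W       ≡⟨ cong (λ s → s + m + (N + b′) * W) (sym p++r) ⟩
    altmajFrom 1 (p ++ r) + m + (N + b′) * W   ∎)
    where
    R   = altmajFrom (suc W) r
    rev = altmajFrom 1 (reverse p)
    alt = altmajFrom 1 p
    N   = nonDesCountFrom 1 p
    regroup₁ : ∀ rev b′ W R m b → rev + b′ * W + R + (m + b) * W ≡ (rev + m * W) + b′ * W + R + b * W
    regroup₁ = solve-∀
    regroup₂ : ∀ alt m N W b′ R b → (alt + m + N * W) + b′ * W + R + b * W ≡ (alt + b * W + R) + m + (N + b′) * W
    regroup₂ = solve-∀

  altmajFrom-reversePrefix : ∀ ys → W ≤ length ys → Linked _≢_ ys →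
                             altmajFrom 1 (reversePrefix W ys) % W ≡ (altmajFrom 1 ys + m) % W
  altmajFrom-reversePrefix ys W≤ lnk =
    subst (λ zs → altmajFrom 1 (reversePrefix W ys) % W ≡ (altmajFrom 1 zs + m) % W) (take++drop≡id W ys)
      (altmajFrom-reverse-++ (take W ys) (drop W ys) (length-take-≤ W ys W≤)
        (Linked-++⁻ˡ (take W ys) (subst (Linked _≢_) (sym (take++drop≡id W ys)) lnk)))

  module _ {n : ℕ} (2m≤n : W ≤ n) where

    flipPerm : Vec (Fin n) n → Vec (Fin n) n
    flipPerm π = V.cast (trans (length-reversePrefix W (toList π)) (Vₚ.length-toList π)) (V.fromList (reversePrefix W (toList π)))

    toList-flipPerm : ∀ π → toList (flipPerm π) ≡ reversePrefix W (toList π)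
    toList-flipPerm π = trans (Vₚ.toList-cast _ _) (Vₚ.toList∘fromList _)

    flipPerm-involutive : ∀ π → flipPerm (flipPerm π) ≡ π
    flipPerm-involutive π = trans (sym (Vₚ.cast-is-id refl _)) (Vₚ.toList-injective refl (flipPerm (flipPerm π)) π (begin
      toList (flipPerm (flipPerm π))               ≡⟨ toList-flipPerm (flipPerm π) ⟩
      reversePrefix W (toList (flipPerm π))        ≡⟨ cong (reversePrefix W) (toList-flipPerm π) ⟩
      reversePrefix W (reversePrefix W (toList π)) ≡⟨ reversePrefix-involutive W (toList π) (subst (W ≤_) (sym (Vₚ.length-toList π)) 2m≤n) ⟩
      toList π                                     ∎))

    isPerm-flipPerm : ∀ π → isPerm (flipPerm π) ≡ isPerm π
    isPerm-flipPerm π = trans (cong distinct (toList-flipPerm π)) (distinct-↭ (reversePrefix-↭ W (toList π)))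

    altmaj-flipPerm : ∀ π → isPerm π ≡ true → altmaj (flipPerm π) % W ≡ (altmaj π + m) % W
    altmaj-flipPerm π perm =
      trans (cong (λ zs → altmajFrom 1 zs % W) toℕ-flipPerm)
            (altmajFrom-reversePrefix ys 2m≤|ys| (Linked.map⁺ (distinct⇒Linked (toList π) perm)))
      where
      ys = map toℕ (toList π)
      toℕ-flipPerm : map toℕ (toList (flipPerm π)) ≡ reversePrefix W ys
      toℕ-flipPerm = trans (cong (map toℕ) (toList-flipPerm π)) (map-reversePrefix toℕ W (toList π))
      2m≤|ys| : W ≤ length ys
      2m≤|ys| = subst (W ≤_) (sym (trans (length-map toℕ (toList π)) (Vₚ.length-toList π))) 2m≤n

    private
      inClass : ℕ → Vec (Fin n) n → Bool
      inClass r π = isPerm π ∧ does (W ∣? ∣ altmaj π - r ∣)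

      countAltmajMod≡count : ∀ r → countAltmajMod n W r ≡ count (inClass r) (allWords n n)
      countAltmajMod≡count r = trans (length-filter (λ π → W ∣? ∣ altmaj π - r ∣) (𝔖 n))
                                     (count-filterᵇ isPerm (λ π → does (W ∣? ∣ altmaj π - r ∣)) (allWords n n))

      inClass-flipPerm : ∀ l π → inClass (l + m) (flipPerm π) ≡ inClass l π
      inClass-flipPerm l π with isPerm π in perm
      ... | false = cong (_∧ does (W ∣? ∣ altmaj (flipPerm π) - (l + m) ∣)) (trans (isPerm-flipPerm π) perm)
      ... | true  = cong₂ _∧_ (trans (isPerm-flipPerm π) perm)
                      (does-cong (∣∣-∣-shift _ _ m l W (altmaj-flipPerm π perm)) (W ∣? _) (W ∣? _))

    countAltmajMod-shift : ∀ l → countAltmajMod n W l ≡ countAltmajMod n W (l + m)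
    countAltmajMod-shift l = begin
      countAltmajMod n W l                            ≡⟨ countAltmajMod≡count l ⟩
      count (inClass l) (allWords n n)                ≡⟨ count-cong (λ π → sym (inClass-flipPerm l π)) (allWords n n) ⟩
      count (inClass (l + m) ∘ flipPerm) (allWords n n) ≡⟨ sym (count-involution flipPerm flipPerm-involutive (allWords n n)
                                                            (allWords-unique n n) (allWords-complete n n) (inClass (l + m))) ⟩
      count (inClass (l + m)) (allWords n n)          ≡⟨ sym (countAltmajMod≡count (l + m)) ⟩
      countAltmajMod n W (l + m)                      ∎

-- Division by 1 + q^m

applyUpTo-cong : {A : Set} {f g : ℕ → A} → (∀ i → f i ≡ g i) → ∀ K → applyUpTo f K ≡ applyUpTo g K
applyUpTo-cong {f = f} {g} f≗g K = trans (sym (map-upTo f K)) (trans (map-cong f≗g (upTo K)) (map-upTo g K))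

coeff-applyUpTo : ∀ N (f : ℕ → ℤ) → (∀ k → N ≤ k → f k ≡ ℤ.+ 0) → ∀ k → coeff (applyUpTo f N) k ≡ f k
coeff-applyUpTo zero    f f≡0 k       = sym (f≡0 k z≤n)
coeff-applyUpTo (suc N) f f≡0 zero    = refl
coeff-applyUpTo (suc N) f f≡0 (suc k) = coeff-applyUpTo N (f ∘ suc) (λ k N≤k → f≡0 (suc k) (s≤s N≤k)) k

coeff-map-upTo : ∀ N (f : ℕ → ℤ) → (∀ k → N ≤ k → f k ≡ ℤ.+ 0) → ∀ k → coeff (map f (upTo N)) k ≡ f k
coeff-map-upTo N f f≡0 k = trans (cong (λ p → coeff p k) (map-upTo f N)) (coeff-applyUpTo N f f≡0 k)

coeff-replicate-∷ʳ-1 : ∀ a i → coeff (replicate a (ℤ.+ 0) ++ ℤ.+ 1 ∷ []) i ≡ (if i ≡ᵇ a then ℤ.+ 1 else ℤ.+ 0)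
coeff-replicate-∷ʳ-1 zero    zero    = refl
coeff-replicate-∷ʳ-1 zero    (suc i) = refl
coeff-replicate-∷ʳ-1 (suc a) zero    = refl
coeff-replicate-∷ʳ-1 (suc a) (suc i) = coeff-replicate-∷ʳ-1 a i

∑ℤ : List ℤ → ℤ
∑ℤ = foldr ℤ._+_ (ℤ.+ 0)

∑ℤ-applyUpTo-zero : ∀ K → ∑ℤ (applyUpTo (λ _ → ℤ.+ 0) K) ≡ ℤ.+ 0
∑ℤ-applyUpTo-zero zero    = refl
∑ℤ-applyUpTo-zero (suc K) = trans (ℤₚ.+-identityˡ _) (∑ℤ-applyUpTo-zero K)

∑ℤ-applyUpTo-≡ᵇ : ∀ K a (g : ℕ → ℤ) →
                  ∑ℤ (applyUpTo (λ i → (if i ≡ᵇ a then ℤ.+ 1 else ℤ.+ 0) ℤ.* g i) K) ≡ (if a <ᵇ K then g a else ℤ.+ 0)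
∑ℤ-applyUpTo-≡ᵇ zero    a       g = refl
∑ℤ-applyUpTo-≡ᵇ (suc K) zero    g = trans (cong₂ ℤ._+_ (ℤₚ.*-identityˡ (g 0)) (∑ℤ-applyUpTo-zero K)) (ℤₚ.+-identityʳ (g 0))
∑ℤ-applyUpTo-≡ᵇ (suc K) (suc a) g = trans (ℤₚ.+-identityˡ _) (∑ℤ-applyUpTo-≡ᵇ K a (g ∘ suc))

coeffMul-onePlusQ^ : ∀ m .{{_ : NonZero m}} g k →
                     coeffMul (onePlusQ^ m) g k ≡ coeff g k ℤ.+ (if m ≤ᵇ k then coeff g (k ∸ m) else ℤ.+ 0)
coeffMul-onePlusQ^ m@(suc m′) g k = begin
  ∑ℤ (map term (upTo (suc k)))               ≡⟨ cong ∑ℤ (map-upTo term (suc k)) ⟩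
  term 0 ℤ.+ ∑ℤ (applyUpTo (term ∘ suc) k)   ≡⟨ cong₂ ℤ._+_ (ℤₚ.*-identityˡ (coeff g k)) (cong ∑ℤ (applyUpTo-cong shifted-term k)) ⟩
  coeff g k ℤ.+ ∑ℤ (applyUpTo (λ i → (if i ≡ᵇ m′ then ℤ.+ 1 else ℤ.+ 0) ℤ.* coeff g (k ∸ suc i)) k)
                                             ≡⟨ cong (λ s → coeff g k ℤ.+ s) (∑ℤ-applyUpTo-≡ᵇ k m′ (λ i → coeff g (k ∸ suc i))) ⟩
  coeff g k ℤ.+ (if m′ <ᵇ k then coeff g (k ∸ m) else ℤ.+ 0) ∎
  where
  term : ℕ → ℤ
  term i = coeff (onePlusQ^ m) i ℤ.* coeff g (k ∸ i)
  shifted-term : ∀ i → term (suc i) ≡ (if i ≡ᵇ m′ then ℤ.+ 1 else ℤ.+ 0) ℤ.* coeff g (k ∸ suc i)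
  shifted-term i = cong (ℤ._* coeff g (k ∸ suc i)) (coeff-replicate-∷ʳ-1 m′ i)

module _ (m : ℕ) .{{_ : NonZero m}} (c : ℕ → ℕ) (N : ℕ) (c-vanishes : ∀ j → N ≤ j → c j ≡ 0)
         (balanced : ∀ l B → l < m → N ≤ l + 2 * m * B →
                     ∑[ u < B ] c (l + 2 * m * u) ≡ ∑[ u < B ] c (l + m + 2 * m * u)) where

  -- (1 + q^m) g = f forces g(k) = f(k) − g(k − m): quotientAt l t is g(l + t m).
  quotientAt : ℕ → ℕ → ℤ
  quotientAt l zero    = ℤ.+ c l
  quotientAt l (suc t) = ℤ.+ c (l + suc t * m) ℤ.- quotientAt l t

  quotient : ℕ → ℤ
  quotient k = quotientAt (k % m) (k / m)

  quotientAt-odd : ∀ l T → quotientAt l (suc (2 * T)) ≡ ℤ.+ (∑[ u < suc T ] c (l + m + 2 * m * u)) ℤ.- ℤ.+ (∑[ u < suc T ] c (l + 2 * m * u))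
  quotientAt-odd l zero    = cong₂ (λ i j → ℤ.+ c i ℤ.- ℤ.+ c j) (index₁ l m) (index₀ l m)
    where
    index₁ : ∀ l m → l + 1 * m ≡ l + m + 2 * m * 0
    index₁ = solve-∀
    index₀ : ∀ l m → l ≡ l + 2 * m * 0
    index₀ = solve-∀
  quotientAt-odd l (suc T) = begin
    quotientAt l (suc (2 * suc T))                                     ≡⟨ cong (λ t → quotientAt l (suc t)) (*-suc 2 T) ⟩
    ℤ.+ c (l + (3 + 2 * T) * m) ℤ.- (ℤ.+ c (l + (2 + 2 * T) * m) ℤ.- quotientAt l (suc (2 * T)))
                                                                       ≡⟨ cong₂ (λ i j → ℤ.+ c i ℤ.- (ℤ.+ c j ℤ.- quotientAt l (suc (2 * T)))) (index₁ l m T) (index₀ l m T) ⟩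
    ℤ.+ c₁ ℤ.- (ℤ.+ c₀ ℤ.- quotientAt l (suc (2 * T)))                 ≡⟨ cong (λ q → ℤ.+ c₁ ℤ.- (ℤ.+ c₀ ℤ.- q)) (quotientAt-odd l T) ⟩
    ℤ.+ c₁ ℤ.- (ℤ.+ c₀ ℤ.- (ℤ.+ S₁ ℤ.- ℤ.+ S₀))                        ≡⟨ regroup (ℤ.+ c₁) (ℤ.+ c₀) (ℤ.+ S₁) (ℤ.+ S₀) ⟩
    (ℤ.+ S₁ ℤ.+ ℤ.+ c₁) ℤ.- (ℤ.+ S₀ ℤ.+ ℤ.+ c₀)                        ≡⟨ cong₂ ℤ._-_ (sym (ℤₚ.pos-+ S₁ c₁)) (sym (ℤₚ.pos-+ S₀ c₀)) ⟩
    ℤ.+ (S₁ + c₁) ℤ.- ℤ.+ (S₀ + c₀)                                    ∎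
    where
    S₁ = ∑[ u < suc T ] c (l + m + 2 * m * u)
    S₀ = ∑[ u < suc T ] c (l + 2 * m * u)
    c₁ = c (l + m + 2 * m * suc T)
    c₀ = c (l + 2 * m * suc T)
    index₁ : ∀ l m T → l + (3 + 2 * T) * m ≡ l + m + 2 * m * suc T
    index₁ = solve-∀
    index₀ : ∀ l m T → l + (2 + 2 * T) * m ≡ l + 2 * m * suc T
    index₀ = solve-∀
    regroup : ∀ a b x y → a ℤ.- (b ℤ.- (x ℤ.- y)) ≡ (x ℤ.+ a) ℤ.- (y ℤ.+ b)
    regroup = ℤ-Ring.solve-∀

  quotientAt-odd-vanishes : ∀ l T → l < m → N ≤ l + 2 * m * suc T → quotientAt l (suc (2 * T)) ≡ ℤ.+ 0
  quotientAt-odd-vanishes l T l<m N≤ = begin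
    quotientAt l (suc (2 * T))  ≡⟨ quotientAt-odd l T ⟩
    ℤ.+ S₁ ℤ.- ℤ.+ S₀           ≡⟨ cong (λ s → ℤ.+ s ℤ.- ℤ.+ S₀) (sym (balanced l (suc T) l<m N≤)) ⟩
    ℤ.+ S₀ ℤ.- ℤ.+ S₀           ≡⟨ ℤₚ.+-inverseʳ (ℤ.+ S₀) ⟩
    ℤ.+ 0                       ∎
    where
    S₁ = ∑[ u < suc T ] c (l + m + 2 * m * u)
    S₀ = ∑[ u < suc T ] c (l + 2 * m * u)

  private
    data ParityView : ℕ → Set where
      even : ∀ T → ParityView (2 * T)
      odd  : ∀ T → ParityView (suc (2 * T))

    parityView : ∀ t → ParityView t
    parityView zero = even 0
    parityView (suc t) with parityView t
    ... | even T = odd T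
    ... | odd T  = subst ParityView (*-suc 2 T) (even (suc T))

  quotientAt-vanishes : ∀ l t → l < m → N ≤ l + t * m → quotientAt l t ≡ ℤ.+ 0
  quotientAt-vanishes l t l<m N≤ with parityView t
  ... | even zero    = cong ℤ.+_ (c-vanishes l (subst (N ≤_) (+-identityʳ l) N≤))
  ... | odd T        = quotientAt-odd-vanishes l T l<m (≤-trans N≤ (≤-reflexive-+ (odd-index l m T)))
    where
    odd-index : ∀ l m T → l + 2 * m * suc T ≡ l + suc (2 * T) * m + m
    odd-index = solve-∀
    ≤-reflexive-+ : ∀ {a b} → b ≡ a + m → a ≤ b
    ≤-reflexive-+ {a} refl = m≤m+n a m
  ... | even (suc T) = begin
    quotientAt l (2 * suc T)                                           ≡⟨ cong (quotientAt l) (*-suc 2 T) ⟩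
    ℤ.+ c (l + (2 + 2 * T) * m) ℤ.- quotientAt l (suc (2 * T))          ≡⟨ cong₂ (λ a b → ℤ.+ a ℤ.- b) (c-vanishes _ N≤′) (quotientAt-odd-vanishes l T l<m (subst (N ≤_) (even-index l m T) N≤′)) ⟩
    ℤ.+ 0                                                              ∎
    where
    N≤′ : N ≤ l + (2 + 2 * T) * m
    N≤′ = subst (λ t → N ≤ l + t * m) (*-suc 2 T) N≤
    even-index : ∀ l m T → l + (2 + 2 * T) * m ≡ l + 2 * m * suc T
    even-index = solve-∀

  quotient-vanishes : ∀ k → N ≤ k → quotient k ≡ ℤ.+ 0
  quotient-vanishes k N≤k = quotientAt-vanishes (k % m) (k / m) (m%n<n k m) (subst (N ≤_) (m≡m%n+[m/n]*n k m) N≤k)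

  quotient-< : ∀ k → k < m → quotient k ≡ ℤ.+ c k
  quotient-< k k<m = cong₂ quotientAt (m<n⇒m%n≡m k<m) (m<n⇒m/n≡0 k<m)

  quotient-≥ : ∀ k → m ≤ k → quotient k ≡ ℤ.+ c k ℤ.- quotient (k ∸ m)
  quotient-≥ k m≤k = trans (cong₂ quotientAt %-shift /-shift) (cong (λ i → ℤ.+ c i ℤ.- quotient (k ∸ m)) index)
    where
    k′ = k ∸ m
    %-shift : k % m ≡ k′ % m
    %-shift = trans (cong (_% m) (sym (m∸n+n≡m m≤k))) ([m+n]%n≡m%n k′ m)
    /-shift : k / m ≡ suc (k′ / m)
    /-shift = m/n≡1+[m∸n]/n m≤k
    index : k′ % m + suc (k′ / m) * m ≡ k
    index = begin
      k′ % m + suc (k′ / m) * m   ≡⟨ regroup (k′ % m) (k′ / m) m ⟩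
      (k′ % m + k′ / m * m) + m   ≡⟨ cong (_+ m) (sym (m≡m%n+[m/n]*n k′ m)) ⟩
      k′ + m                      ≡⟨ m∸n+n≡m m≤k ⟩
      k                           ∎
      where
      regroup : ∀ r q m → r + suc q * m ≡ (r + q * m) + m
      regroup = solve-∀

  c≡quotient+shifted : ∀ k → ℤ.+ c k ≡ quotient k ℤ.+ (if m ≤ᵇ k then quotient (k ∸ m) else ℤ.+ 0)
  c≡quotient+shifted k with m ≤ᵇ k in m≤ᵇk
  ... | true  = sym (trans (cong (ℤ._+ quotient (k ∸ m)) (quotient-≥ k m≤k)) (cancel (ℤ.+ c k) (quotient (k ∸ m))))
    where
    m≤k : m ≤ k
    m≤k = ≤ᵇ⇒≤ m k (Equivalence.from T-≡ m≤ᵇk)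
    cancel : ∀ a b → (a ℤ.- b) ℤ.+ b ≡ a
    cancel = ℤ-Ring.solve-∀
  ... | false = sym (trans (ℤₚ.+-identityʳ (quotient k)) (quotient-< k (≰⇒> m≰k)))
    where
    m≰k : m ≰ k
    m≰k m≤k = subst T m≤ᵇk (≤⇒≤ᵇ m≤k)

  onePlusQ^-∣ₚ : onePlusQ^ m ∣ₚ map (λ j → ℤ.+ c j) (upTo N)
  onePlusQ^-∣ₚ = g , λ k → begin
    coeff (map (λ j → ℤ.+ c j) (upTo N)) k                                  ≡⟨ coeff-map-upTo N _ (λ j N≤j → cong ℤ.+_ (c-vanishes j N≤j)) k ⟩
    ℤ.+ c k                                                                 ≡⟨ c≡quotient+shifted k ⟩
    quotient k ℤ.+ (if m ≤ᵇ k then quotient (k ∸ m) else ℤ.+ 0)       ≡⟨ sym (cong₂ (λ a b → a ℤ.+ (if m ≤ᵇ k then b else ℤ.+ 0)) (coeff-g k) (coeff-g (k ∸ m))) ⟩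
    coeff g k ℤ.+ (if m ≤ᵇ k then coeff g (k ∸ m) else ℤ.+ 0)         ≡⟨ sym (coeffMul-onePlusQ^ m g k) ⟩
    coeffMul (onePlusQ^ m) g k                                              ∎
    where
    g = map quotient (upTo N)
    coeff-g : ∀ j → coeff g j ≡ quotient j
    coeff-g = coeff-map-upTo N quotient quotient-vanishes

altmajFrom-≤ : ∀ i x ys → altmajFrom i (x ∷ ys) ≤ length ys * (i + length ys)
altmajFrom-≤ i x []       = z≤n
altmajFrom-≤ i x (y ∷ ys) =
  ≤-trans (+-mono-≤ (desWeight-≤ (altDesAt i x y)) (altmajFrom-≤ (suc i) y ys))
          (subst (i + L * (suc i + L) ≤_) (regroup i L) (m≤m+n (i + L * (suc i + L)) (suc L)))
  where
  L = length ys
  desWeight-≤ : ∀ b → (if b then i else 0) ≤ i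
  desWeight-≤ true  = ≤-refl
  desWeight-≤ false = z≤n
  regroup : ∀ i L → i + L * (suc i + L) + suc L ≡ suc L * (i + suc L)
  regroup = solve-∀

altmaj-< : ∀ {n} .{{_ : NonZero n}} (π : Vec (Fin n) n) → altmaj π < n * n
altmaj-< {suc n′} (x V.∷ π) =
  s≤s (≤-trans (altmajFrom-≤ 1 (toℕ x) ys) (subst (λ L → L * suc L ≤ n′ + n′ * suc n′) (sym |ys|) (m≤n+m (n′ * suc n′) n′)))
  where
  ys = map toℕ (toList π)
  |ys| : length ys ≡ n′
  |ys| = trans (length-map toℕ (toList π)) (Vₚ.length-toList π)

module _ (n : ℕ) .{{_ : NonZero n}} where

  countAltmajEq-vanishes : ∀ j → n * n ≤ j → countAltmajEq n j ≡ 0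
  countAltmajEq-vanishes j n²≤j = trans (length-filter (λ π → altmaj π ≟ j) (𝔖 n))
    (count-false _ (λ π → dec-false (altmaj π ≟ j) (λ eq → <⇒≱ (altmaj-< π) (subst (n * n ≤_) (sym eq) n²≤j))) (𝔖 n))

  countAltmajMod≡∑ : ∀ W .{{_ : NonZero W}} l B → l < W → n * n ≤ l + W * B →
                     countAltmajMod n W l ≡ ∑[ u < B ] countAltmajEq n (l + W * u)
  countAltmajMod≡∑ W l B l<W n²≤ = begin
    countAltmajMod n W l                                      ≡⟨ length-filter (λ π → W ∣? ∣ altmaj π - l ∣) (𝔖 n) ⟩
    count (λ π → does (W ∣? ∣ altmaj π - l ∣)) (𝔖 n)           ≡⟨ count-∣∣-∣≡∑ W altmaj (𝔖 n) l B l<W (λ π → <-≤-trans (altmaj-< π) n²≤) ⟩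
    ∑[ u < B ] count (λ π → does (altmaj π ≟ l + W * u)) (𝔖 n) ≡⟨ ∑<-cong B _ _ (λ u _ → sym (length-filter (λ π → altmaj π ≟ l + W * u) (𝔖 n))) ⟩
    ∑[ u < B ] countAltmajEq n (l + W * u)                    ∎

  countAltmajEq-balanced : ∀ m .{{_ : NonZero m}} → 2 * m ≤ n → ∀ l B → l < m → n * n ≤ l + 2 * m * B →
                           ∑[ u < B ] countAltmajEq n (l + 2 * m * u) ≡ ∑[ u < B ] countAltmajEq n (l + m + 2 * m * u)
  countAltmajEq-balanced m 2m≤n l B l<m n²≤ = begin
    ∑[ u < B ] countAltmajEq n (l + 2 * m * u)     ≡⟨ sym (countAltmajMod≡∑ (2 * m) l B (<-≤-trans l<m (m≤n*m m 2)) n²≤) ⟩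
    countAltmajMod n (2 * m) l                     ≡⟨ countAltmajMod-shift m 2m≤n l ⟩
    countAltmajMod n (2 * m) (l + m)               ≡⟨ countAltmajMod≡∑ (2 * m) (l + m) B l+m<2m (≤-trans n²≤ (+-monoˡ-≤ (2 * m * B) (m≤m+n l m))) ⟩
    ∑[ u < B ] countAltmajEq n (l + m + 2 * m * u) ∎
    where
    instance
      2m≢0 : NonZero (2 * m)
      2m≢0 = m*n≢0 2 m
    l+m<2m : l + m < 2 * m
    l+m<2m = subst (l + m <_) (sym (2*m≡m+m m)) (+-monoˡ-< m l<m)
      where
      2*m≡m+m : ∀ m → 2 * m ≡ m + m
      2*m≡m+m = solve-∀

theorem4p9 : (n m : ℕ) → 1 ≤ n → 1 ≤ m → m ≤ n / 2 →
             ((l : ℕ) → l < m → countAltmajMod n (2 * m) l ≡ countAltmajMod n (2 * m) (l + m))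
             × (onePlusQ^ m ∣ₚ altmajPoly n)
theorem4p9 n m 1≤n 1≤m m≤n/2 =
  (λ l _ → countAltmajMod-shift m 2m≤n l) ,
  onePlusQ^-∣ₚ m (countAltmajEq n) (n * n) (countAltmajEq-vanishes n) (countAltmajEq-balanced n m 2m≤n)
  where
  instance
    n≢0 : NonZero n
    n≢0 = >-nonZero 1≤n
    m≢0 : NonZero m
    m≢0 = >-nonZero 1≤m
  2m≤n : 2 * m ≤ n
  2m≤n = ≤-trans (*-monoʳ-≤ 2 m≤n/2) (subst (_≤ n) (*-comm (n / 2) 2) (m/n*n≤m n 2))
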